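{- Let $a,d$ be numbers and let $A_{n,k}(a,d)$ be the general Eulerian numbers defined in the context. Then for every integer $n\ge 1$ and every positive integer $i$, $$(a+(i-1)d)^n=\sum_{j=-1}^{n-1} A_{n,j}(a,d)\binom{i+j}{n}.$$
   Context: For numbers $a,d$ (associated with the arithmetic progression $a, a+d, a+2d,\dots$), the general Eulerian numbers $A_{n,k}(a,d)$, for integers $n\ge 0$ and $k$, are defined by: $A_{0,-1}(a,d)=1$; $A_{n,k}(a,d)=0$ whenever $k\ge n$ or $k\le -2$; and for $n\ge 1$ and $-1\le k\le n-1$, $$A_{n,k}(a,d)=(-a+(k+2)d)\,A_{n-1,k}(a,d)+(a+(n-k-1)d)\,A_{n-1,k-1}(a,d).$$ Binomial coefficients $\binom{x}{n}$ are the usual ones (equal to $0$ when $0\le x<n$). -}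

module Defs where

open import Level using (Level)
open import Algebra.Bundles using (CommutativeRing)
open import Data.Nat as ℕ using (ℕ; zero; suc)
open import Data.Nat.Combinatorics using (_C_)
open import Data.Integer as ℤ using (ℤ; +_; -[1+_])
open import Relation.Nullary.Decidable.Core using (does)
open import Data.Bool using (Bool; true; false; if_then_else_; _∨_)
open import Data.List using (List; []; _∷_; upTo; map; foldr)

module _ {c ℓ : Level} (R : CommutativeRing c ℓ) where
  open CommutativeRing R

  _·ℕ_ : ℕ → Carrier → Carrier
  zero ·ℕ x = 0#
  suc m ·ℕ x = x + (m ·ℕ x)

  _·ℤ_ : ℤ → Carrier → Carrier
  (+ m) ·ℤ x = m ·ℕ x
  -[1+ m ] ·ℤ x = - (suc m ·ℕ x)

  _^_ : Carrier → ℕ → Carrier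
  x ^ zero = 1#
  x ^ suc m = x * (x ^ m)

  A : Carrier → Carrier → ℕ → ℤ → Carrier
  A a d zero -[1+ zero ] = 1#
  A a d zero (+ _) = 0#
  A a d zero -[1+ suc _ ] = 0#
  A a d (suc n) k =
    if does (k ℤ.<? -[1+ 0 ]) ∨ does ((+ n) ℤ.<? k)
    then 0#
    else ((- a + ((k ℤ.+ + 2) ·ℤ d)) * A a d n k
          + (a + (((+ suc n) ℤ.- k ℤ.- + 1) ·ℤ d)) * A a d n (k ℤ.- + 1))

  sumFromMinus1 : ℕ → (ℤ → Carrier) → Carrier
  sumFromMinus1 n f = foldr _+_ 0# (map (λ m → f ((+ m) ℤ.- + 1)) (upTo (suc n)))

module Submission where

-- Write i = i'+1, x = a + i'd, and shift the summation index to m = j+1, so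
-- that E_n(m) = A_{n,m-1} and the claim reads  x^n = Σ_{m=0}^{n} E_n(m)·C(i'+m, n).  Multiplying the identity for n by x, each
-- summand x·E_n(m)·C(i'+m,n) splits (Pascal's rule plus the absorption identity
-- (k+1)·C(t,k+1) + k·C(t,k) = t·C(t,k)) into the two contributions
--   (-a+(m+1)d)·E_n(m)·C(i'+m,n+1)   and   (a+(n-m)d)·E_n(m)·C(i'+m+1,n+1),
-- which are exactly the two terms of the defining recurrence of E_{n+1}.
-- Shifting the index of the first family by one regroups the sum as
-- Σ_m E_{n+1}(m)·C(i'+m,n+1).

open import Defs
open import Level using (Level)
open import Algebra.Bundles using (CommutativeRing)
open import Data.Nat using (ℕ; _≤_)
open import Data.Nat.Combinatorics using (_C_; nCk+nC[k+1]≡[n+1]C[k+1])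
open import Data.Integer as ℤ using (ℤ; +_; ∣_∣)

open import Data.Nat as ℕ using (zero; suc; _<_; _∸_; s≤s)
import Data.Nat.Properties as ℕₚ
open import Data.List using (applyUpTo; foldr)
open import Data.List.Properties using (map-applyUpTo)
open import Data.Maybe using (nothing)
open import Relation.Nullary.Decidable using (dec-true; dec-false)
open import Data.Bool using (Bool; true; false; if_then_else_)
open import Data.Sum using (inj₁; inj₂)
open import Relation.Binary.PropositionalEquality as ≡ using (_≡_)
open import Tactic.RingSolver.Core.AlmostCommutativeRing using (fromCommutativeRing)

module Binomial where
  open Data.Nat using (_+_; _*_)
  open import Data.Nat.Properties
  open import Data.Nat.Combinatorics using (nC1≡n)
  open import Data.Nat.Tactic.RingSolver using (solve-∀)
  open ≡ using (refl; cong; cong₂; sym; trans)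
  open ≡.≡-Reasoning

  -- Absorption identity (k+1)·C(t,k+1) = (t-k)·C(t,k), in subtraction-free form.
  -- Proved by induction on t: after Pascal's rule the left side regroups into
  -- the instances of the hypothesis at k+1 and at k.
  absorption : ∀ t k → suc k * (t C suc k) + k * (t C k) ≡ t * (t C k)
  absorption zero    zero    = refl
  absorption zero    (suc k) = cong₂ _+_ (*-zeroʳ (suc (suc k))) (*-zeroʳ (suc k))
  absorption (suc t) zero    =
    trans (+-identityʳ (1 * (suc t C 1)))
          (trans (*-identityˡ (suc t C 1)) (trans (nC1≡n (suc t)) (sym (*-identityʳ (suc t)))))
  absorption (suc t) (suc k) = begin
    suc (suc k) * (suc t C suc (suc k)) + suc k * (suc t C suc k)
      ≡⟨ cong₂ (λ p q → suc (suc k) * p + suc k * q) (sym (nCk+nC[k+1]≡[n+1]C[k+1] t (suc k)))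
                                                     (sym (nCk+nC[k+1]≡[n+1]C[k+1] t k)) ⟩
    suc (suc k) * (Y + Z) + suc k * (X + Y)
      ≡⟨ regroup k X Y Z ⟩
    (suc (suc k) * Z + suc k * Y) + ((suc k * Y + k * X) + (X + Y))
      ≡⟨ cong₂ (λ p q → p + (q + (X + Y))) (absorption t (suc k)) (absorption t k) ⟩
    t * Y + (t * X + (X + Y))
      ≡⟨ collect t X Y ⟩
    suc t * (X + Y)
      ≡⟨ cong (suc t *_) (nCk+nC[k+1]≡[n+1]C[k+1] t k) ⟩
    suc t * (suc t C suc k) ∎
    where
    X : ℕ
    X = t C k
    Y : ℕ
    Y = t C suc k
    Z : ℕ
    Z = t C suc (suc k)
    regroup : ∀ k x y z → suc (suc k) * (y + z) + suc k * (x + y)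
                        ≡ (suc (suc k) * z + suc k * y) + ((suc k * y + k * x) + (x + y))
    regroup = solve-∀
    collect : ∀ t x y → t * y + (t * x + (x + y)) ≡ suc t * (x + y)
    collect = solve-∀

  -- The numerical core of the induction step: for m ≤ n and t = i + m,
  --   (n+1)·C(t,n+1) + (n-m)·C(t,n) = i·C(t,n).
  -- It follows from absorption at k = n after cancelling m·C(t,n).
  absorption-shifted : ∀ i m n → m ≤ n →
    suc n * ((i + m) C suc n) + (n ∸ m) * ((i + m) C n) ≡ i * ((i + m) C n)
  absorption-shifted i m n m≤n = +-cancelʳ-≡ (m * Q) _ _ (begin
    (suc n * P + (n ∸ m) * Q) + m * Q ≡⟨ +-assoc (suc n * P) _ _ ⟩
    suc n * P + ((n ∸ m) * Q + m * Q) ≡⟨ cong (λ z → suc n * P + z) (sym (*-distribʳ-+ Q (n ∸ m) m)) ⟩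
    suc n * P + ((n ∸ m) + m) * Q     ≡⟨ cong (λ k → suc n * P + k * Q) (m∸n+n≡m m≤n) ⟩
    suc n * P + n * Q                 ≡⟨ absorption (i + m) n ⟩
    (i + m) * Q                       ≡⟨ *-distribʳ-+ Q i m ⟩
    i * Q + m * Q                     ∎)
    where
    P : ℕ
    P = (i + m) C suc n
    Q : ℕ
    Q = (i + m) C n

open Binomial using (absorption-shifted)

module _ {c ℓ : Level} (R : CommutativeRing c ℓ) where
  open CommutativeRing R
  open import Relation.Binary.Reasoning.Setoid setoid
  open import Algebra.Properties.Semiring.Mult semiring
    using (_×_; ×-homo-+; ×1-homo-*; ×-assoc-*; ×-congʳ)
  open import Tactic.RingSolver.NonReflective (fromCommutativeRing R (λ _ → nothing))

  ι : ℕ → Carrier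
  ι k = k × 1#

  ·ℕ≡× : ∀ m x → _·ℕ_ R m x ≡ m × x
  ·ℕ≡× zero    x = ≡.refl
  ·ℕ≡× (suc m) x = ≡.cong (λ y → x + y) (·ℕ≡× m x)

  ·ℕ≈ι* : ∀ m x → _·ℕ_ R m x ≈ ι m * x
  ·ℕ≈ι* m x = begin
    _·ℕ_ R m x    ≡⟨ ·ℕ≡× m x ⟩
    m × x         ≈⟨ ×-congʳ m (*-identityˡ x) ⟨
    m × (1# * x)  ≈⟨ ×-assoc-* m 1# x ⟨
    ι m * x       ∎

  ι-sum-of-products : ∀ p q r s → ι (p ℕ.* q ℕ.+ r ℕ.* s) ≈ ι p * ι q + ι r * ι s
  ι-sum-of-products p q r s = begin
    ι (p ℕ.* q ℕ.+ r ℕ.* s)        ≈⟨ ×-homo-+ 1# (p ℕ.* q) (r ℕ.* s) ⟩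
    ι (p ℕ.* q) + ι (r ℕ.* s)      ≈⟨ +-cong (×1-homo-* p q) (×1-homo-* r s) ⟩
    ι p * ι q + ι r * ι s          ∎

  Σ : ℕ → (ℕ → Carrier) → Carrier
  Σ N g = foldr _+_ 0# (applyUpTo g N)

  Σ-cong : ∀ N {f g : ℕ → Carrier} → (∀ m → f m ≈ g m) → Σ N f ≈ Σ N g
  Σ-cong zero    f≈g = refl
  Σ-cong (suc N) f≈g = +-cong (f≈g 0) (Σ-cong N (λ m → f≈g (suc m)))

  Σ-distribˡ : ∀ N x (f : ℕ → Carrier) → x * Σ N f ≈ Σ N (λ m → x * f m)
  Σ-distribˡ zero    x f = zeroʳ x
  Σ-distribˡ (suc N) x f =
    trans (distribˡ x (f 0) _) (+-cong refl (Σ-distribˡ N x (λ m → f (suc m))))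

  Σ-shift : ∀ N (f g : ℕ → Carrier) → f N ≈ 0# →
    Σ N (λ m → f m + g m) ≈ f 0 + Σ N (λ m → f (suc m) + g m)
  Σ-shift zero    f g f0≈0 = sym (trans (+-cong f0≈0 refl) (+-identityʳ 0#))
  Σ-shift (suc N) f g fN≈0 = begin
    (f 0 + g 0) + Σ N (λ m → f (suc m) + g (suc m))
      ≈⟨ +-cong refl (Σ-shift N (λ m → f (suc m)) (λ m → g (suc m)) fN≈0) ⟩
    (f 0 + g 0) + (f 1 + S)
      ≈⟨ solve 4 (λ f₀ g₀ f₁ s → ((f₀ ⊕ g₀) ⊕ (f₁ ⊕ s)) ⊜ (f₀ ⊕ ((f₁ ⊕ g₀) ⊕ s)))
               refl (f 0) (g 0) (f 1) S ⟩
    f 0 + ((f 1 + g 0) + S) ∎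
    where
    S : Carrier
    S = Σ N (λ m → f (suc (suc m)) + g (suc m))

  sumFromMinus1≡Σ : ∀ n f → sumFromMinus1 R n f ≡ Σ (suc n) (λ m → f ((+ m) ℤ.- + 1))
  sumFromMinus1≡Σ n f = ≡.cong (foldr _+_ 0#) (map-applyUpTo (λ m → m) _ (suc n))

  module Eulerian (a d : Carrier) where
    import Data.Integer.Tactic.RingSolver as ℤ-Solver

    E : ℕ → ℕ → Carrier
    E n m = A R a d n ((+ m) ℤ.- + 1)

    -- The two coefficients of the recurrence, in shifted indexing:
    --   E_{n+1}(m) = lower m · E_n(m) + upper n (m-1) · E_n(m-1).
    lower : ℕ → Carrier
    lower m = - a + ι (suc m) * d

    upper : ℕ → ℕ → Carrier
    upper n m = a + ι (n ∸ m) * d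

    if-true : ∀ {b : Bool} {x y : Carrier} → b ≡ true → (if b then x else y) ≈ x
    if-true ≡.refl = refl

    if-false : ∀ {b : Bool} {x y : Carrier} → b ≡ false → (if b then x else y) ≈ y
    if-false ≡.refl = refl

    E-vanish : ∀ {n m} → n < m → E n m ≈ 0#
    E-vanish {zero}  {suc m} _         = refl
    E-vanish {suc n} {suc m} (s≤s n<m) = if-true (dec-true ((+ n) ℤ.<? (+ m)) (ℤ.+<+ n<m))

    A-below-range : ∀ n → A R a d n (ℤ.-[1+ 1 ]) ≈ 0#
    A-below-range zero    = refl
    A-below-range (suc n) = refl

    E-rec-zero : ∀ n → E (suc n) 0 ≈ lower 0 * E n 0
    E-rec-zero n =
      trans (+-cong (*-cong (+-cong refl (·ℕ≈ι* 1 d)) refl)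
                    (trans (*-cong refl (A-below-range n)) (zeroʳ _)))
            (+-identityʳ _)

    upper-index : ∀ {m n} → m ≤ n → (+ suc n) ℤ.- (+ m) ℤ.- + 1 ≡ + (n ∸ m)
    upper-index {m} {n} m≤n = ≡.trans
      (≡.cong (λ k → (+ suc k) ℤ.- (+ m) ℤ.- + 1) (≡.sym (ℕₚ.m+[n∸m]≡n m≤n)))
      (cancel (+ m) (+ (n ∸ m)))
      where
      cancel : ∀ (x y : ℤ) → (+ 1 ℤ.+ (x ℤ.+ y)) ℤ.- x ℤ.- + 1 ≡ y
      cancel = ℤ-Solver.solve-∀

    -- The recurrence at m + 1.  Beyond the top index (n < m) the range test of A
    -- makes the left side 0, and so is the right side by E-vanish.
    E-rec-suc : ∀ n m → E (suc n) (suc m) ≈ lower (suc m) * E n (suc m) + upper n m * E n m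
    E-rec-suc n m with ℕₚ.≤-<-connex m n
    ... | inj₂ n<m = begin
      E (suc n) (suc m)                   ≈⟨ if-true (dec-true ((+ n) ℤ.<? (+ m)) (ℤ.+<+ n<m)) ⟩
      0#                                  ≈⟨ +-identityʳ 0# ⟨
      0# + 0#                             ≈⟨ +-cong (zeroʳ _) (zeroʳ _) ⟨
      lower (suc m) * 0# + upper n m * 0# ≈⟨ +-cong (*-cong refl (E-vanish (ℕₚ.m<n⇒m<1+n n<m)))
                                                    (*-cong refl (E-vanish n<m)) ⟨
      lower (suc m) * E n (suc m) + upper n m * E n m ∎
    ... | inj₁ m≤n =
      trans (if-false (dec-false ((+ n) ℤ.<? (+ m)) (λ { (ℤ.+<+ n<m) → ℕₚ.<⇒≱ n<m m≤n })))
            (+-cong (*-cong lower-coeff refl) (*-cong upper-coeff refl))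
      where
      lower-coeff : - a + _·ℕ_ R (m ℕ.+ 2) d ≈ lower (suc m)
      lower-coeff = +-cong refl (trans (·ℕ≈ι* (m ℕ.+ 2) d)
                                       (*-cong (reflexive (≡.cong ι (ℕₚ.+-comm m 2))) refl))
      upper-coeff : a + _·ℤ_ R ((+ suc n) ℤ.- (+ m) ℤ.- + 1) d ≈ upper n m
      upper-coeff = +-cong refl (trans (reflexive (≡.cong (λ k → _·ℤ_ R k d) (upper-index m≤n)))
                                       (·ℕ≈ι* (n ∸ m) d))

    module Worpitzky (i : ℕ) where
      open import Algebra.Properties.CommutativeSemigroup *-commutativeSemigroup using (x∙yz≈y∙xz)

      -- The base of the power; i here is i - 1 in the statement of the theorem.
      x : Carrier
      x = a + _·ℕ_ R i d

      term : ℕ → ℕ → Carrier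
      term n m = E n m * ι ((i ℕ.+ m) C n)

      -- After Pascal's rule the a-terms cancel to a·C(t,n) and the d-terms
      -- reduce to i·d·C(t,n) by absorption-shifted.
      coefficient-identity : ∀ {m n} → m ≤ n →
        lower m * ι ((i ℕ.+ m) C suc n) + upper n m * ι (suc (i ℕ.+ m) C suc n)
          ≈ x * ι ((i ℕ.+ m) C n)
      coefficient-identity {m} {n} m≤n = begin
        lower m * P + upper n m * ι (suc t C suc n)
          ≈⟨ +-cong refl (*-cong refl (reflexive (≡.cong ι (≡.sym (nCk+nC[k+1]≡[n+1]C[k+1] t n))))) ⟩
        lower m * P + upper n m * ι (t C n ℕ.+ t C suc n)
          ≈⟨ +-cong refl (*-cong refl (×-homo-+ 1# (t C n) (t C suc n))) ⟩
        (- a + ι (suc m) * d) * P + (a + ι r * d) * (Q + P)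
          ≈⟨ solve 7 (λ na a d p q u v → (((na ⊕ u ⊗ d) ⊗ p) ⊕ ((a ⊕ v ⊗ d) ⊗ (q ⊕ p)))
                                        ⊜ (((na ⊕ a) ⊗ p) ⊕ ((a ⊗ q) ⊕ (d ⊗ (((u ⊕ v) ⊗ p) ⊕ (v ⊗ q))))))
                  refl (- a) a d P Q (ι (suc m)) (ι r) ⟩
        (- a + a) * P + (a * Q + d * ((ι (suc m) + ι r) * P + ι r * Q))
          ≈⟨ trans (+-cong (trans (*-cong (-‿inverseˡ a) refl) (zeroˡ P)) refl) (+-identityˡ _) ⟩
        a * Q + d * ((ι (suc m) + ι r) * P + ι r * Q)
          ≈⟨ +-cong refl (*-cong refl (+-cong (*-cong row-length refl) refl)) ⟩
        a * Q + d * (ι (suc n) * P + ι r * Q)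
          ≈⟨ +-cong refl (*-cong refl binomial-part) ⟩
        a * Q + d * (ι i * Q)
          ≈⟨ solve 4 (λ a d q v → ((a ⊗ q) ⊕ (d ⊗ (v ⊗ q))) ⊜ ((a ⊕ v ⊗ d) ⊗ q)) refl a d Q (ι i) ⟩
        (a + ι i * d) * Q
          ≈⟨ *-cong (+-cong refl (·ℕ≈ι* i d)) refl ⟨
        x * Q ∎
        where
        t : ℕ
        t = i ℕ.+ m
        r : ℕ
        r = n ∸ m
        P : Carrier
        P = ι (t C suc n)
        Q : Carrier
        Q = ι (t C n)
        row-length : ι (suc m) + ι r ≈ ι (suc n)
        row-length = trans (sym (×-homo-+ 1# (suc m) r))
                           (reflexive (≡.cong (λ k → ι (suc k)) (ℕₚ.m+[n∸m]≡n m≤n)))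
        binomial-part : ι (suc n) * P + ι r * Q ≈ ι i * Q
        binomial-part = begin
          ι (suc n) * P + ι r * Q                       ≈⟨ ι-sum-of-products (suc n) (t C suc n) r (t C n) ⟨
          ι (suc n ℕ.* (t C suc n) ℕ.+ r ℕ.* (t C n))  ≡⟨ ≡.cong ι (absorption-shifted i m n m≤n) ⟩
          ι (i ℕ.* (t C n))                            ≈⟨ ×1-homo-* i (t C n) ⟩
          ι i * Q                                      ∎

      lowered : ℕ → ℕ → Carrier
      lowered n m = lower m * (E n m * ι ((i ℕ.+ m) C suc n))

      raised : ℕ → ℕ → Carrier
      raised n m = upper n m * (E n m * ι (suc (i ℕ.+ m) C suc n))

      -- x times a summand of row n splits into its two contributions to row n+1.
      -- Beyond the top index both sides vanish with E_n(m).
      summand-split : ∀ n m → x * term n m ≈ lowered n m + raised n m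
      summand-split n m = begin
        x * (E n m * Q)
          ≈⟨ x∙yz≈y∙xz x (E n m) Q ⟩
        E n m * (x * Q)
          ≈⟨ weighted ⟩
        E n m * (lower m * P + upper n m * P′)
          ≈⟨ distribˡ (E n m) _ _ ⟩
        E n m * (lower m * P) + E n m * (upper n m * P′)
          ≈⟨ +-cong (x∙yz≈y∙xz (E n m) (lower m) P) (x∙yz≈y∙xz (E n m) (upper n m) P′) ⟩
        lowered n m + raised n m ∎
        where
        P : Carrier
        P = ι ((i ℕ.+ m) C suc n)
        P′ : Carrier
        P′ = ι (suc (i ℕ.+ m) C suc n)
        Q : Carrier
        Q = ι ((i ℕ.+ m) C n)
        weighted : E n m * (x * Q) ≈ E n m * (lower m * P + upper n m * P′)
        weighted with ℕₚ.≤-<-connex m n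
        ... | inj₁ m≤n = *-cong refl (sym (coefficient-identity m≤n))
        ... | inj₂ n<m = trans (*-cong (E-vanish n<m) refl)
                               (trans (zeroˡ _) (sym (trans (*-cong (E-vanish n<m) refl) (zeroˡ _))))

      term-rec-zero : ∀ n → term (suc n) 0 ≈ lowered n 0
      term-rec-zero n = trans (*-cong (E-rec-zero n) refl) (*-assoc _ _ _)

      term-rec-suc : ∀ n m → term (suc n) (suc m) ≈ lowered n (suc m) + raised n m
      term-rec-suc n m = begin
        E (suc n) (suc m) * P
          ≈⟨ *-cong (E-rec-suc n m) refl ⟩
        (lower (suc m) * E n (suc m) + upper n m * E n m) * P
          ≈⟨ distribʳ P _ _ ⟩
        (lower (suc m) * E n (suc m)) * P + (upper n m * E n m) * P
          ≈⟨ +-cong (*-assoc _ _ _) (trans (*-assoc _ _ _) (reflexive shift-top)) ⟩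
        lowered n (suc m) + raised n m ∎
        where
        P : Carrier
        P = ι ((i ℕ.+ suc m) C suc n)
        shift-top : upper n m * (E n m * P) ≡ raised n m
        shift-top = ≡.cong (λ k → upper n m * (E n m * ι (k C suc n))) (ℕₚ.+-suc i m)

      lowered-top : ∀ n → lowered n (suc n) ≈ 0#
      lowered-top n =
        trans (*-cong refl (trans (*-cong (E-vanish (ℕₚ.n<1+n n)) refl) (zeroˡ _))) (zeroʳ _)

      worpitzky : ∀ n → _^_ R x n ≈ Σ (suc n) (term n)
      worpitzky zero    = sym (trans (+-identityʳ _) (trans (*-identityˡ _) (+-identityʳ 1#)))
      worpitzky (suc n) = begin
        x * _^_ R x n
          ≈⟨ *-cong refl (worpitzky n) ⟩
        x * Σ (suc n) (term n)
          ≈⟨ Σ-distribˡ (suc n) x (term n) ⟩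
        Σ (suc n) (λ m → x * term n m)
          ≈⟨ Σ-cong (suc n) (summand-split n) ⟩
        Σ (suc n) (λ m → lowered n m + raised n m)
          ≈⟨ Σ-shift (suc n) (lowered n) (raised n) (lowered-top n) ⟩
        lowered n 0 + Σ (suc n) (λ m → lowered n (suc m) + raised n m)
          ≈⟨ +-cong (term-rec-zero n) (Σ-cong (suc n) (term-rec-suc n)) ⟨
        Σ (suc (suc n)) (term (suc n)) ∎

binomial-top : ∀ i m → ∣ (+ suc i) ℤ.+ ((+ m) ℤ.- + 1) ∣ ≡ i ℕ.+ m
binomial-top i zero    = ≡.sym (ℕₚ.+-identityʳ i)
binomial-top i (suc m) = ≡.sym (ℕₚ.+-suc i m)

-- Writing i = i' + 1, the base is x = a + i'·d and the summand at
-- j = m - 1 is term n m, so the claim is worpitzky n re-indexed.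
lemma2p3 : {c ℓ : Level} (R : CommutativeRing c ℓ) →
    let open CommutativeRing R in
    (a d : Carrier) (n i : ℕ) → 1 ≤ n → 1 ≤ i →
      _^_ R (a + _·ℤ_ R ((+ i) ℤ.- + 1) d) n
        ≈ sumFromMinus1 R n (λ j → A R a d n j * _·ℕ_ R (∣ (+ i) ℤ.+ j ∣ C n) 1#)
lemma2p3 R a d n (suc i) _ _ =
  trans (worpitzky n)
        (trans (Σ-cong R (suc n) summand-form)
               (reflexive (≡.sym (sumFromMinus1≡Σ R n summand))))
  where
  open CommutativeRing R
  open Eulerian R a d
  open Worpitzky i
  summand : ℤ → Carrier
  summand j = A R a d n j * _·ℕ_ R (∣ (+ suc i) ℤ.+ j ∣ C n) 1#
  summand-form : ∀ m → term n m ≈ summand ((+ m) ℤ.- + 1)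
  summand-form m = *-cong refl (reflexive (≡.trans top-index (≡.sym (·ℕ≡× R binomial 1#))))
    where
    binomial : ℕ
    binomial = ∣ (+ suc i) ℤ.+ ((+ m) ℤ.- + 1) ∣ C n
    top-index : ι R ((i ℕ.+ m) C n) ≡ ι R binomial
    top-index = ≡.cong (λ t → ι R (t C n)) (≡.sym (binomial-top i m))
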